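{- Let $H$ be a non-trivial Boolean algebra (i.e. $\bot\ne\top$). Then $(x\wedge\neg y)\vee(\neg x\wedge y)$ is a non-trivial apartness term in $H$, and it is the unique one up to equivalence of terms: every non-trivial apartness term $x\#y$ in $H$ satisfies $x\#y=(x\wedge\neg y)\vee(\neg x\wedge y)$ for all $x,y\in H$.
   Context: A term $x\# y$ (a term in the first-order language of Heyting algebras, i.e. built from $x,y$ using $\wedge,\vee,\rightarrow,\bot,\top$, with $\neg a := a\rightarrow\bot$) is an apartness term in $H$ if for all $x,y,z\in H$: $x\#x=\bot$; $x\#y=y\#x$; $x\#y\le (x\#z)\vee(z\#y)$. It is trivial if $x\#y=\bot$ for all $x,y\in H$, and non-trivial otherwise. -}

module Defs where

open import Level using (Level)
open import Data.Product using (_×_)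
open import Relation.Nullary using (¬_)
open import Relation.Binary.Lattice.Bundles using (HeytingAlgebra; BooleanAlgebra)

data Term : Set where
  varX varY : Term
  _∧ₜ_ _∨ₜ_ _⇒ₜ_ : Term → Term → Term
  ⊥ₜ ⊤ₜ : Term

infixr 7 _∧ₜ_
infixr 6 _∨ₜ_
infixr 5 _⇒ₜ_

¬ₜ_ : Term → Term
¬ₜ a = a ⇒ₜ ⊥ₜ

infix 8 ¬ₜ_

symDiffₜ : Term
symDiffₜ = (varX ∧ₜ ¬ₜ varY) ∨ₜ (¬ₜ varX ∧ₜ varY)

module _ {c ℓ₁ ℓ₂ : Level} (H : HeytingAlgebra c ℓ₁ ℓ₂) where
  open HeytingAlgebra H

  ⟦_⟧ : Term → Carrier → Carrier → Carrier
  ⟦ varX ⟧ a b = a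
  ⟦ varY ⟧ a b = b
  ⟦ s ∧ₜ t ⟧ a b = ⟦ s ⟧ a b ∧ ⟦ t ⟧ a b
  ⟦ s ∨ₜ t ⟧ a b = ⟦ s ⟧ a b ∨ ⟦ t ⟧ a b
  ⟦ s ⇒ₜ t ⟧ a b = ⟦ s ⟧ a b ⇨ ⟦ t ⟧ a b
  ⟦ ⊥ₜ ⟧ a b = ⊥
  ⟦ ⊤ₜ ⟧ a b = ⊤

  IsApartnessTerm : Term → Set (c Level.⊔ ℓ₁ Level.⊔ ℓ₂)
  IsApartnessTerm t =
    (∀ x → ⟦ t ⟧ x x ≈ ⊥)
    × (∀ x y → ⟦ t ⟧ x y ≈ ⟦ t ⟧ y x)
    × (∀ x y z → ⟦ t ⟧ x y ≤ (⟦ t ⟧ x z ∨ ⟦ t ⟧ z y))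

  IsTrivial : Term → Set (c Level.⊔ ℓ₁)
  IsTrivial t = ∀ x y → ⟦ t ⟧ x y ≈ ⊥

  IsNonTrivial : Term → Set (c Level.⊔ ℓ₁)
  IsNonTrivial t = ¬ IsTrivial t

-- Write x ⊕ y for the symmetric difference (x ∧ ¬y) ∨ (¬x ∧ y). It is the
-- addition of the Boolean ring of H, so x ⊕ x = ⊥, x ⊕ y = y ⊕ x and
-- x ⊕ y = (x ⊕ z) ⊕ (z ⊕ y) ≤ (x ⊕ z) ∨ (z ⊕ y): it is an apartness term, and
-- a non-trivial one since ⊤ ⊕ ⊥ = ⊤ ≠ ⊥.
--
-- Conversely, meeting with c is a Boolean-algebra morphism onto the interval
-- [⊥, c], so c ∧ t(x, y) only depends on c ∧ x and c ∧ y. Splitting along x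
-- and along y gives the Shannon expansion of any term t in terms of its four
-- values t(⊤,⊤), t(⊤,⊥), t(⊥,⊤), t(⊥,⊥), each of which is ⊥ or ⊤. For an
-- apartness term these are ⊥, d, d, ⊥, so t(x, y) = (x ⊕ y) ∧ d with d ∈ {⊥, ⊤};
-- non-triviality rules out d = ⊥.
module Submission where

open import Defs
open import Level using (Level)
open import Data.Product using (_×_; _,_)
open import Data.Sum as Sum using (_⊎_; inj₁; inj₂)
open import Relation.Binary.Lattice.Bundles using (BooleanAlgebra; HeytingAlgebra)
open import Relation.Nullary.Negation using (contradiction)
open import Algebra.Bundles using (IdempotentCommutativeMonoid)
import Algebra.Lattice as Alg
import Algebra.Lattice.Properties.BooleanAlgebra as BooleanAlgebraProperties
import Algebra.Properties.IdempotentCommutativeMonoid as IdempotentCommutativeMonoidProperties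
import Relation.Binary.Lattice.Properties.BoundedJoinSemilattice as BoundedJoinSemilatticeProperties
import Relation.Binary.Lattice.Properties.DistributiveLattice as DistributiveLatticeProperties
import Relation.Binary.Lattice.Properties.HeytingAlgebra as HeytingAlgebraProperties
import Relation.Binary.Lattice.Properties.Lattice as LatticeProperties
import Relation.Binary.Reasoning.PartialOrder as ≤-Reasoning

module _ {c ℓ₁ ℓ₂ : Level} (H : BooleanAlgebra c ℓ₁ ℓ₂) where
  open BooleanAlgebra H
  open HeytingAlgebraProperties heytingAlgebra
    using (⇨-unit; ⇨-eval; ⇨-cong; distributiveLattice)
  open DistributiveLatticeProperties distributiveLattice
    using (∨-distrib-∧; ∧-distrib-∨)
  open BoundedJoinSemilatticeProperties boundedJoinSemilattice
    using () renaming (identityʳ to ∨-identityʳ)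
  open import Relation.Binary.Lattice.Properties.MeetSemilattice meetSemilattice
    using (∧-comm; ∧-cong)
  open import Relation.Binary.Lattice.Properties.JoinSemilattice joinSemilattice
    using (∨-comm)

  private
    ¬≈⇨⊥ : ∀ x → ¬ x ≈ x ⇨ ⊥
    ¬≈⇨⊥ x = Eq.sym (∨-identityʳ (¬ x))

    ∧-complementˡ : ∀ x → ¬ x ∧ x ≈ ⊥
    ∧-complementˡ x =
      antisym (trans (reflexive (∧-cong (¬≈⇨⊥ x) Eq.refl)) ⇨-eval) (minimum _)

  isAlgBooleanAlgebra : Alg.IsBooleanAlgebra _≈_ _∨_ _∧_ ¬_ ⊤ ⊥
  isAlgBooleanAlgebra = record
    { isDistributiveLattice = record
      { isLattice   = LatticeProperties.isAlgLattice lattice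
      ; ∨-distrib-∧ = ∨-distrib-∧
      ; ∧-distrib-∨ = ∧-distrib-∨
      }
    ; ∨-complement = (λ x → ⇨-unit) , (λ x → Eq.trans (∨-comm x (¬ x)) ⇨-unit)
    ; ∧-complement = ∧-complementˡ , (λ x → Eq.trans (∧-comm x (¬ x)) (∧-complementˡ x))
    ; ¬-cong       = λ {x} {y} x≈y →
        Eq.trans (¬≈⇨⊥ x) (Eq.trans (⇨-cong x≈y Eq.refl) (Eq.sym (¬≈⇨⊥ y)))
    }

  algBooleanAlgebra : Alg.BooleanAlgebra c ℓ₁
  algBooleanAlgebra = record { isBooleanAlgebra = isAlgBooleanAlgebra }

module Properties {c ℓ : Level} (B : Alg.BooleanAlgebra c ℓ) where
  open Alg.BooleanAlgebra B
  open BooleanAlgebraProperties B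
  open import Relation.Binary.Reasoning.Setoid setoid

  ∧-idempotentCommutativeMonoid : IdempotentCommutativeMonoid c ℓ
  ∧-idempotentCommutativeMonoid = record
    { isIdempotentCommutativeMonoid = record
      { isCommutativeMonoid = ∧-⊤-isCommutativeMonoid
      ; idem                = ∧-idem
      }
    }

  ∧-distribˡ-∧ : ∀ x y z → x ∧ (y ∧ z) ≈ (x ∧ y) ∧ (x ∧ z)
  ∧-distribˡ-∧ = IdempotentCommutativeMonoidProperties.∙-distrˡ-∙ ∧-idempotentCommutativeMonoid

  x∧¬[x∧y]≈x∧¬y : ∀ x y → x ∧ ¬ (x ∧ y) ≈ x ∧ ¬ y
  x∧¬[x∧y]≈x∧¬y x y = begin
    x ∧ ¬ (x ∧ y)          ≈⟨ ∧-congˡ (deMorgan₁ x y) ⟩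
    x ∧ (¬ x ∨ ¬ y)        ≈⟨ ∧-distribˡ-∨ x (¬ x) (¬ y) ⟩
    x ∧ ¬ x ∨ x ∧ ¬ y      ≈⟨ ∨-congʳ (∧-complementʳ x) ⟩
    ⊥ ∨ x ∧ ¬ y            ≈⟨ ∨-identityˡ _ ⟩
    x ∧ ¬ y                ∎

  x≈[c∧x]∨[¬c∧x] : ∀ c x → x ≈ c ∧ x ∨ ¬ c ∧ x
  x≈[c∧x]∨[¬c∧x] c x = begin
    x                  ≈⟨ ∧-identityˡ x ⟨
    ⊤ ∧ x              ≈⟨ ∧-congʳ (∨-complementʳ c) ⟨
    (c ∨ ¬ c) ∧ x      ≈⟨ ∧-distribʳ-∨ x c (¬ c) ⟩
    c ∧ x ∨ ¬ c ∧ x    ∎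

  infix 4 _≈[_]_
  _≈[_]_ : Carrier → Carrier → Carrier → Set ℓ
  x ≈[ c ] y = c ∧ x ≈ c ∧ y

  ∧-resp-≈[] : ∀ {c x y u v} → x ≈[ c ] y → u ≈[ c ] v → x ∧ u ≈[ c ] y ∧ v
  ∧-resp-≈[] {c} x≈y u≈v = begin
    c ∧ (_ ∧ _)          ≈⟨ ∧-distribˡ-∧ c _ _ ⟩
    (c ∧ _) ∧ (c ∧ _)    ≈⟨ ∧-cong x≈y u≈v ⟩
    (c ∧ _) ∧ (c ∧ _)    ≈⟨ ∧-distribˡ-∧ c _ _ ⟨
    c ∧ (_ ∧ _)          ∎

  ∨-resp-≈[] : ∀ {c x y u v} → x ≈[ c ] y → u ≈[ c ] v → x ∨ u ≈[ c ] y ∨ v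
  ∨-resp-≈[] {c} x≈y u≈v = begin
    c ∧ (_ ∨ _)          ≈⟨ ∧-distribˡ-∨ c _ _ ⟩
    c ∧ _ ∨ c ∧ _        ≈⟨ ∨-cong x≈y u≈v ⟩
    c ∧ _ ∨ c ∧ _        ≈⟨ ∧-distribˡ-∨ c _ _ ⟨
    c ∧ (_ ∨ _)          ∎

  ¬-resp-≈[] : ∀ {c x y} → x ≈[ c ] y → ¬ x ≈[ c ] ¬ y
  ¬-resp-≈[] {c} {x} {y} x≈y = begin
    c ∧ ¬ x              ≈⟨ x∧¬[x∧y]≈x∧¬y c x ⟨
    c ∧ ¬ (c ∧ x)        ≈⟨ ∧-congˡ (¬-cong x≈y) ⟩
    c ∧ ¬ (c ∧ y)        ≈⟨ x∧¬[x∧y]≈x∧¬y c y ⟩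
    c ∧ ¬ y              ∎

  x≈[x]⊤ : ∀ x → x ≈[ x ] ⊤
  x≈[x]⊤ x = trans (∧-idem x) (sym (∧-identityʳ x))

  x≈[¬x]⊥ : ∀ x → x ≈[ ¬ x ] ⊥
  x≈[¬x]⊥ x = trans (∧-complementˡ x) (sym (∧-zeroʳ (¬ x)))

  [x∨y]∧¬x≈y∧¬x : ∀ x y → (x ∨ y) ∧ ¬ x ≈ y ∧ ¬ x
  [x∨y]∧¬x≈y∧¬x x y = begin
    (x ∨ y) ∧ ¬ x        ≈⟨ ∧-distribʳ-∨ (¬ x) x y ⟩
    x ∧ ¬ x ∨ y ∧ ¬ x    ≈⟨ ∨-congʳ (∧-complementʳ x) ⟩
    ⊥ ∨ y ∧ ¬ x          ≈⟨ ∨-identityˡ _ ⟩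
    y ∧ ¬ x              ∎

  ⊕≈[x∧¬y]∨[¬x∧y] : ∀ x y → x ⊕ y ≈ x ∧ ¬ y ∨ ¬ x ∧ y
  ⊕≈[x∧¬y]∨[¬x∧y] x y = begin
    (x ∨ y) ∧ ¬ (x ∧ y)                ≈⟨ ∧-congˡ (deMorgan₁ x y) ⟩
    (x ∨ y) ∧ (¬ x ∨ ¬ y)              ≈⟨ ∧-distribˡ-∨ (x ∨ y) (¬ x) (¬ y) ⟩
    (x ∨ y) ∧ ¬ x ∨ (x ∨ y) ∧ ¬ y      ≈⟨ ∨-cong ([x∨y]∧¬x≈y∧¬x x y)
                                             (trans (∧-congʳ (∨-comm x y)) ([x∨y]∧¬x≈y∧¬x y x)) ⟩
    y ∧ ¬ x ∨ x ∧ ¬ y                  ≈⟨ ∨-comm _ _ ⟩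
    x ∧ ¬ y ∨ y ∧ ¬ x                  ≈⟨ ∨-congˡ (∧-comm y (¬ x)) ⟩
    x ∧ ¬ y ∨ ¬ x ∧ y                  ∎

  [x⊕z]⊕[z⊕y]≈x⊕y : ∀ x y z → (x ⊕ z) ⊕ (z ⊕ y) ≈ x ⊕ y
  [x⊕z]⊕[z⊕y]≈x⊕y x y z = begin
    (x ⊕ z) ⊕ (z ⊕ y)    ≈⟨ ⊕-assoc x z (z ⊕ y) ⟩
    x ⊕ (z ⊕ (z ⊕ y))    ≈⟨ ⊕-cong refl (⊕-assoc z z y) ⟨
    x ⊕ ((z ⊕ z) ⊕ y)    ≈⟨ ⊕-cong refl (⊕-cong (⊕-inverseˡ z) refl) ⟩
    x ⊕ (⊥ ⊕ y)          ≈⟨ ⊕-cong refl (⊕-identityˡ y) ⟩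
    x ⊕ y                ∎
    where open DefaultXorRing using (⊕-cong; ⊕-assoc; ⊕-inverseˡ; ⊕-identityˡ)

  Is⊥⊤ : Carrier → Set ℓ
  Is⊥⊤ x = x ≈ ⊥ ⊎ x ≈ ⊤

  ∧-preserves-⊥⊤ : ∀ {x y} → Is⊥⊤ x → Is⊥⊤ y → Is⊥⊤ (x ∧ y)
  ∧-preserves-⊥⊤ (inj₁ x≈⊥) _ = inj₁ (trans (∧-congʳ x≈⊥) (∧-zeroˡ _))
  ∧-preserves-⊥⊤ {x} {y} (inj₂ x≈⊤) y∈⊥⊤ = Sum.map (trans x∧y≈y) (trans x∧y≈y) y∈⊥⊤
    where
    x∧y≈y : x ∧ y ≈ y
    x∧y≈y = trans (∧-congʳ x≈⊤) (∧-identityˡ y)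

  ∨-preserves-⊥⊤ : ∀ {x y} → Is⊥⊤ x → Is⊥⊤ y → Is⊥⊤ (x ∨ y)
  ∨-preserves-⊥⊤ (inj₂ x≈⊤) _ = inj₂ (trans (∨-congʳ x≈⊤) (∨-zeroˡ _))
  ∨-preserves-⊥⊤ {x} {y} (inj₁ x≈⊥) y∈⊥⊤ = Sum.map (trans x∨y≈y) (trans x∨y≈y) y∈⊥⊤
    where
    x∨y≈y : x ∨ y ≈ y
    x∨y≈y = trans (∨-congʳ x≈⊥) (∨-identityˡ y)

  ¬-preserves-⊥⊤ : ∀ {x} → Is⊥⊤ x → Is⊥⊤ (¬ x)
  ¬-preserves-⊥⊤ (inj₁ x≈⊥) = inj₂ (trans (¬-cong x≈⊥) ¬⊥≈⊤)
  ¬-preserves-⊥⊤ (inj₂ x≈⊤) = inj₁ (trans (¬-cong x≈⊤) ¬⊤≈⊥)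

module _ {c ℓ₁ ℓ₂ : Level} (H : BooleanAlgebra c ℓ₁ ℓ₂) where
  open Alg.BooleanAlgebra (algBooleanAlgebra H)
  open BooleanAlgebraProperties (algBooleanAlgebra H)
    using (_⊕_; module DefaultXorRing; ∧-identityʳ; ∧-zeroʳ; ∨-identityˡ; ∨-identityʳ)
  open DefaultXorRing using (⊕-comm; ⊕-identityʳ; ⊕-inverseˡ)
  open Properties (algBooleanAlgebra H)
  open BooleanAlgebra H using (heytingAlgebra; _≤_; poset; x∧y≤x)

  private
    HA : HeytingAlgebra c ℓ₁ ℓ₂
    HA = heytingAlgebra

  ⟦⟧-resp-≈[] : ∀ t {c x x′ y y′} → x ≈[ c ] x′ → y ≈[ c ] y′ →
                ⟦ HA ⟧ t x y ≈[ c ] ⟦ HA ⟧ t x′ y′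
  ⟦⟧-resp-≈[] varX     x≈x′ y≈y′ = x≈x′
  ⟦⟧-resp-≈[] varY     x≈x′ y≈y′ = y≈y′
  ⟦⟧-resp-≈[] (s ∧ₜ t) x≈x′ y≈y′ = ∧-resp-≈[] (⟦⟧-resp-≈[] s x≈x′ y≈y′) (⟦⟧-resp-≈[] t x≈x′ y≈y′)
  ⟦⟧-resp-≈[] (s ∨ₜ t) x≈x′ y≈y′ = ∨-resp-≈[] (⟦⟧-resp-≈[] s x≈x′ y≈y′) (⟦⟧-resp-≈[] t x≈x′ y≈y′)
  ⟦⟧-resp-≈[] (s ⇒ₜ t) x≈x′ y≈y′ =
    ∨-resp-≈[] (¬-resp-≈[] (⟦⟧-resp-≈[] s x≈x′ y≈y′)) (⟦⟧-resp-≈[] t x≈x′ y≈y′)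
  ⟦⟧-resp-≈[] ⊥ₜ       x≈x′ y≈y′ = refl
  ⟦⟧-resp-≈[] ⊤ₜ       x≈x′ y≈y′ = refl

  ⟦⟧-expandˡ : ∀ t x y → ⟦ HA ⟧ t x y ≈ x ∧ ⟦ HA ⟧ t ⊤ y ∨ ¬ x ∧ ⟦ HA ⟧ t ⊥ y
  ⟦⟧-expandˡ t x y = trans (x≈[c∧x]∨[¬c∧x] x _)
    (∨-cong (⟦⟧-resp-≈[] t (x≈[x]⊤ x) refl) (⟦⟧-resp-≈[] t (x≈[¬x]⊥ x) refl))

  ⟦⟧-expandʳ : ∀ t x y → ⟦ HA ⟧ t x y ≈ y ∧ ⟦ HA ⟧ t x ⊤ ∨ ¬ y ∧ ⟦ HA ⟧ t x ⊥
  ⟦⟧-expandʳ t x y = trans (x≈[c∧x]∨[¬c∧x] y _)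
    (∨-cong (⟦⟧-resp-≈[] t refl (x≈[x]⊤ y)) (⟦⟧-resp-≈[] t refl (x≈[¬x]⊥ y)))

  ⟦⟧-preserves-⊥⊤ : ∀ t {x y} → Is⊥⊤ x → Is⊥⊤ y → Is⊥⊤ (⟦ HA ⟧ t x y)
  ⟦⟧-preserves-⊥⊤ varX     x∈ y∈ = x∈
  ⟦⟧-preserves-⊥⊤ varY     x∈ y∈ = y∈
  ⟦⟧-preserves-⊥⊤ (s ∧ₜ t) x∈ y∈ = ∧-preserves-⊥⊤ (⟦⟧-preserves-⊥⊤ s x∈ y∈) (⟦⟧-preserves-⊥⊤ t x∈ y∈)
  ⟦⟧-preserves-⊥⊤ (s ∨ₜ t) x∈ y∈ = ∨-preserves-⊥⊤ (⟦⟧-preserves-⊥⊤ s x∈ y∈) (⟦⟧-preserves-⊥⊤ t x∈ y∈)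
  ⟦⟧-preserves-⊥⊤ (s ⇒ₜ t) x∈ y∈ =
    ∨-preserves-⊥⊤ (¬-preserves-⊥⊤ (⟦⟧-preserves-⊥⊤ s x∈ y∈)) (⟦⟧-preserves-⊥⊤ t x∈ y∈)
  ⟦⟧-preserves-⊥⊤ ⊥ₜ       x∈ y∈ = inj₁ refl
  ⟦⟧-preserves-⊥⊤ ⊤ₜ       x∈ y∈ = inj₂ refl

  ⟦symDiff⟧≈⊕ : ∀ x y → ⟦ HA ⟧ symDiffₜ x y ≈ x ⊕ y
  ⟦symDiff⟧≈⊕ x y = trans (∨-cong (∧-congˡ (∨-identityʳ (¬ y))) (∧-congʳ (∨-identityʳ (¬ x))))
                          (sym (⊕≈[x∧¬y]∨[¬x∧y] x y))

  symDiff-isApartnessTerm : IsApartnessTerm HA symDiffₜ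
  symDiff-isApartnessTerm = irreflexive , symmetric , cotransitive
    where
    irreflexive : ∀ x → ⟦ HA ⟧ symDiffₜ x x ≈ ⊥
    irreflexive x = trans (⟦symDiff⟧≈⊕ x x) (⊕-inverseˡ x)

    symmetric : ∀ x y → ⟦ HA ⟧ symDiffₜ x y ≈ ⟦ HA ⟧ symDiffₜ y x
    symmetric x y = trans (⟦symDiff⟧≈⊕ x y) (trans (⊕-comm x y) (sym (⟦symDiff⟧≈⊕ y x)))

    cotransitive : ∀ x y z →
                   ⟦ HA ⟧ symDiffₜ x y ≤ ⟦ HA ⟧ symDiffₜ x z ∨ ⟦ HA ⟧ symDiffₜ z y
    cotransitive x y z = begin
      ⟦ HA ⟧ symDiffₜ x y                        ≈⟨ trans (⟦symDiff⟧≈⊕ x y) (sym ([x⊕z]⊕[z⊕y]≈x⊕y x y z)) ⟩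
      (x ⊕ z) ⊕ (z ⊕ y)                          ≤⟨ x∧y≤x _ _ ⟩
      (x ⊕ z) ∨ (z ⊕ y)                          ≈⟨ ∨-cong (⟦symDiff⟧≈⊕ x z) (⟦symDiff⟧≈⊕ z y) ⟨
      ⟦ HA ⟧ symDiffₜ x z ∨ ⟦ HA ⟧ symDiffₜ z y  ∎
      where open ≤-Reasoning poset

  symDiff-isNonTrivial : ⊥ ≉ ⊤ → IsNonTrivial HA symDiffₜ
  symDiff-isNonTrivial ⊥≉⊤ trivial =
    ⊥≉⊤ (trans (sym (trivial ⊤ ⊥)) (trans (⟦symDiff⟧≈⊕ ⊤ ⊥) (⊕-identityʳ ⊤)))

  apartnessTerm≈⊕∧ : ∀ t → IsApartnessTerm HA t →
                     ∀ x y → ⟦ HA ⟧ t x y ≈ (x ⊕ y) ∧ ⟦ HA ⟧ t ⊤ ⊥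
  apartnessTerm≈⊕∧ t (irreflexive , symmetric , _) x y = begin
    ⟦ HA ⟧ t x y                                  ≈⟨ ⟦⟧-expandˡ t x y ⟩
    x ∧ ⟦ HA ⟧ t ⊤ y ∨ ¬ x ∧ ⟦ HA ⟧ t ⊥ y         ≈⟨ ∨-cong (∧-congˡ ⊤-row) (∧-congˡ ⊥-row) ⟩
    x ∧ (¬ y ∧ d) ∨ ¬ x ∧ (y ∧ d)                 ≈⟨ ∨-cong (∧-assoc x (¬ y) d) (∧-assoc (¬ x) y d) ⟨
    (x ∧ ¬ y) ∧ d ∨ (¬ x ∧ y) ∧ d                 ≈⟨ ∧-distribʳ-∨ d _ _ ⟨
    (x ∧ ¬ y ∨ ¬ x ∧ y) ∧ d                       ≈⟨ ∧-congʳ (⊕≈[x∧¬y]∨[¬x∧y] x y) ⟨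
    (x ⊕ y) ∧ d                                   ∎
    where
    open import Relation.Binary.Reasoning.Setoid setoid

    d : Carrier
    d = ⟦ HA ⟧ t ⊤ ⊥

    ⊤-row : ⟦ HA ⟧ t ⊤ y ≈ ¬ y ∧ d
    ⊤-row = begin
      ⟦ HA ⟧ t ⊤ y                        ≈⟨ ⟦⟧-expandʳ t ⊤ y ⟩
      y ∧ ⟦ HA ⟧ t ⊤ ⊤ ∨ ¬ y ∧ d          ≈⟨ ∨-congʳ (trans (∧-congˡ (irreflexive ⊤)) (∧-zeroʳ y)) ⟩
      ⊥ ∨ ¬ y ∧ d                         ≈⟨ ∨-identityˡ _ ⟩
      ¬ y ∧ d                             ∎

    ⊥-row : ⟦ HA ⟧ t ⊥ y ≈ y ∧ d
    ⊥-row = begin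
      ⟦ HA ⟧ t ⊥ y                            ≈⟨ ⟦⟧-expandʳ t ⊥ y ⟩
      y ∧ ⟦ HA ⟧ t ⊥ ⊤ ∨ ¬ y ∧ ⟦ HA ⟧ t ⊥ ⊥   ≈⟨ ∨-cong (∧-congˡ (symmetric ⊥ ⊤))
                                                         (trans (∧-congˡ (irreflexive ⊥)) (∧-zeroʳ (¬ y))) ⟩
      y ∧ d ∨ ⊥                               ≈⟨ ∨-identityʳ _ ⟩
      y ∧ d                                   ∎

  apartnessTerm-unique : ∀ t → IsApartnessTerm HA t → IsNonTrivial HA t →
                         ∀ x y → ⟦ HA ⟧ t x y ≈ ⟦ HA ⟧ symDiffₜ x y
  apartnessTerm-unique t isApartness nonTrivial x y
    with ⟦⟧-preserves-⊥⊤ t (inj₂ refl) (inj₁ refl)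
  ... | inj₁ d≈⊥ = contradiction trivial nonTrivial
    where
    trivial : IsTrivial HA t
    trivial x y = trans (apartnessTerm≈⊕∧ t isApartness x y) (trans (∧-congˡ d≈⊥) (∧-zeroʳ _))
  ... | inj₂ d≈⊤ = trans (apartnessTerm≈⊕∧ t isApartness x y)
                         (trans (∧-congˡ d≈⊤) (trans (∧-identityʳ _) (sym (⟦symDiff⟧≈⊕ x y))))

open import Relation.Nullary using (¬_)

mainTheorem11 : {c ℓ₁ ℓ₂ : Level} (H : BooleanAlgebra c ℓ₁ ℓ₂)
    → ¬ (BooleanAlgebra._≈_ H (BooleanAlgebra.⊥ H) (BooleanAlgebra.⊤ H))
    → (IsApartnessTerm (BooleanAlgebra.heytingAlgebra H) symDiffₜ
       × IsNonTrivial (BooleanAlgebra.heytingAlgebra H) symDiffₜ)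
      × ((t : Term)
         → IsApartnessTerm (BooleanAlgebra.heytingAlgebra H) t
         → IsNonTrivial (BooleanAlgebra.heytingAlgebra H) t
         → ∀ x y → BooleanAlgebra._≈_ H
                     (⟦ BooleanAlgebra.heytingAlgebra H ⟧ t x y)
                     (⟦ BooleanAlgebra.heytingAlgebra H ⟧ symDiffₜ x y))
mainTheorem11 H ⊥≉⊤ =
  (symDiff-isApartnessTerm H , symDiff-isNonTrivial H ⊥≉⊤) , apartnessTerm-unique H
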